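{- There are no games $X,Y$ satisfying any of the following: (i) $X$ of type $\mathcal O$, $Y$ of type $\mathcal P$, $X+Y$ of type $\mathcal N$; (ii) $X$ of type $\mathcal N$, $Y$ of type $\mathcal P$, $X+Y$ of type $\mathcal P$; (iii) $X$ and $Y$ of type $\mathcal O$, $X+Y$ of type $\mathcal P$; (iv) $X$ and $Y$ of type $\mathcal P$, $X+Y$ of type $\mathcal O$; (v) $X$ of type $\mathcal O$, $Y$ of type $\mathcal N$, $X+Y$ of type $\mathcal O$.
   Context: A (finite impartial) game is defined recursively as a finite set of games, its options; $0$ is the game with no options. Three players alternate moves cyclically; a move replaces the current game by one of its options, and the player who makes the last move wins. The disjunctive sum $G+H$ is the game whose options are all $G'+H$ ($G'$ an option of $G$) and all $G+H'$ ($H'$ an option of $H$). Types are defined recursively: $G$ is of type $\mathcal N$ iff it has some option of type $\mathcal P$; of type $\mathcal O$ iff it has at least one option and all its options are of type $\mathcal N$; of type $\mathcal P$ iff all its options are of type $\mathcal O$ (so $0$ is of type $\mathcal P$); of type $\mathcal Q$ otherwise. -}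

module Defs where

open import Data.Nat using (ℕ; zero; suc) renaming (_+_ to _+ℕ_)
open import Data.Fin using (Fin; zero; suc; splitAt)
open import Data.Sum using ([_,_])
open import Data.Bool using (Bool; true; false; _∧_; _∨_; if_then_else_)

-- A finite impartial game: a finite family of options (given by n and an
-- indexing Fin n → Game). Repetitions are harmless for everything below.
data Game : Set where
  mk : (n : ℕ) → (Fin n → Game) → Game

zeroG : Game
zeroG = mk zero (λ ())

infixl 6 _⊕_
_⊕_ : Game → Game → Game
G@(mk n f) ⊕ H@(mk m g) =
  mk (n +ℕ m) (λ i → [ (λ j → f j ⊕ H) , (λ j → G ⊕ g j) ] (splitAt n i))

-- the four types of three-player games
data Type : Set where
  𝒩 𝒪 𝒫 𝒬 : Type

anyF : (n : ℕ) → (Fin n → Bool) → Bool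
anyF zero    p = false
anyF (suc n) p = p zero ∨ anyF n (λ i → p (suc i))

allF : (n : ℕ) → (Fin n → Bool) → Bool
allF zero    p = true
allF (suc n) p = p zero ∧ allF n (λ i → p (suc i))

isN isO isP : Type → Bool
isN 𝒩 = true
isN _ = false
isO 𝒪 = true
isO _ = false
isP 𝒫 = true
isP _ = false

nonEmpty : ℕ → Bool
nonEmpty zero = false
nonEmpty (suc _) = true

-- classification from the option types, following the recursive definition:
-- N iff some option is P; O iff at least one option and all options N;
-- P iff all options O; Q otherwise. (These cases are mutually exclusive.)
classify : (n : ℕ) → (Fin n → Type) → Type
classify n t =
  if anyF n (λ i → isP (t i)) then 𝒩
  else if nonEmpty n ∧ allF n (λ i → isN (t i)) then 𝒪
  else if allF n (λ i → isO (t i)) then 𝒫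
  else 𝒬

type : Game → Type
type (mk n f) = classify n (λ i → type (f i))

{-# OPTIONS --safe #-}
-- The five statements, together with the mirror images of (i) and (ii), are
-- proved by one simultaneous induction on X and Y. In each forbidden
-- configuration a single move in one component leads to another forbidden
-- configuration: (i) to (ii) or (iii), (ii) to (iv), (iii) to (v), (iv) to (i),
-- and (v) to (i).
module Submission where

open import Defs
open import Data.Bool using (Bool; true; false; T; if_then_else_; _∧_)
open import Data.Bool.Properties using (T-∧; T-∨)
open import Data.Fin using (Fin; zero; suc; splitAt; _↑ˡ_; _↑ʳ_)
open import Data.Fin.Properties using (splitAt-↑ˡ; splitAt-↑ʳ)
open import Data.Nat using (ℕ; suc) renaming (_+_ to _+ℕ_)
open import Data.Product using (_×_; _,_; proj₁; proj₂; ∃-syntax)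
open import Data.Sum using (inj₁; inj₂; [_,_])
open import Function using (_∘_)
open import Function.Bundles using (Equivalence)
open import Relation.Binary.PropositionalEquality using (_≡_; _≢_; refl; subst)
open import Relation.Nullary using (¬_)

open Equivalence using (to)

anyF-sound : ∀ n (p : Fin n → Bool) → T (anyF n p) → ∃[ i ] T (p i)
anyF-sound (suc n) p h with to T-∨ h
... | inj₁ p0 = zero , p0
... | inj₂ ps = let i , pi = anyF-sound n (p ∘ suc) ps in suc i , pi

allF-sound : ∀ n (p : Fin n → Bool) → T (allF n p) → ∀ i → T (p i)
allF-sound (suc n) p h zero    = proj₁ (to T-∧ h)
allF-sound (suc n) p h (suc i) = allF-sound n (p ∘ suc) (proj₂ (to T-∧ h)) i

nonEmpty-inhabited : ∀ n → T (nonEmpty n) → Fin n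
nonEmpty-inhabited (suc n) _ = zero

isN-sound : ∀ {t} → T (isN t) → t ≡ 𝒩
isN-sound {𝒩} _ = refl

isO-sound : ∀ {t} → T (isO t) → t ≡ 𝒪
isO-sound {𝒪} _ = refl

isP-sound : ∀ {t} → T (isP t) → t ≡ 𝒫
isP-sound {𝒫} _ = refl

cascade : Bool → Bool → Bool → Type
cascade a b c = if a then 𝒩 else if b then 𝒪 else if c then 𝒫 else 𝒬

cascade≡𝒩 : ∀ a b c → cascade a b c ≡ 𝒩 → T a
cascade≡𝒩 true  _     _     _  = _
cascade≡𝒩 false true  _     ()
cascade≡𝒩 false false true  ()
cascade≡𝒩 false false false ()

cascade≡𝒪 : ∀ a b c → cascade a b c ≡ 𝒪 → T b
cascade≡𝒪 true  _     _     ()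
cascade≡𝒪 false true  _     _  = _
cascade≡𝒪 false false true  ()
cascade≡𝒪 false false false ()

cascade≡𝒫 : ∀ a b c → cascade a b c ≡ 𝒫 → T c
cascade≡𝒫 true  _     _     ()
cascade≡𝒫 false true  _     ()
cascade≡𝒫 false false true  _  = _
cascade≡𝒫 false false false ()

module _ (n : ℕ) (t : Fin n → Type) where
  private
    someP someAllN allO : Bool
    someP = anyF n (λ i → isP (t i))
    someAllN = nonEmpty n ∧ allF n (λ i → isN (t i))
    allO = allF n (λ i → isO (t i))

  classify≡𝒩 : classify n t ≡ 𝒩 → ∃[ i ] t i ≡ 𝒫
  classify≡𝒩 h = let i , ti = anyF-sound n _ (cascade≡𝒩 someP someAllN allO h) in i , isP-sound ti

  classify≡𝒪 : classify n t ≡ 𝒪 → Fin n × (∀ i → t i ≡ 𝒩)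
  classify≡𝒪 h =
    let ne , allN = to T-∧ (cascade≡𝒪 someP someAllN allO h)
    in nonEmpty-inhabited n ne , isN-sound ∘ allF-sound n _ allN

  classify≡𝒫 : classify n t ≡ 𝒫 → ∀ i → t i ≡ 𝒪
  classify≡𝒫 h = isO-sound ∘ allF-sound n _ (cascade≡𝒫 someP someAllN allO h)

infix 4 _≺_

data _≺_ : Game → Game → Set where
  option : ∀ {n f} (i : Fin n) → f i ≺ mk n f

𝒩⇒∃𝒫-option : ∀ G → type G ≡ 𝒩 → ∃[ H ] H ≺ G × type H ≡ 𝒫
𝒩⇒∃𝒫-option (mk n f) h = let i , fi = classify≡𝒩 n _ h in f i , option i , fi

𝒪⇒∃𝒩-option : ∀ G → type G ≡ 𝒪 → ∃[ H ] H ≺ G × type H ≡ 𝒩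
𝒪⇒∃𝒩-option (mk n f) h = let i , allN = classify≡𝒪 n _ h in f i , option i , allN i

𝒪⇒option-𝒩 : ∀ {G H} → type G ≡ 𝒪 → H ≺ G → type H ≡ 𝒩
𝒪⇒option-𝒩 h (option i) = proj₂ (classify≡𝒪 _ _ h) i

𝒫⇒option-𝒪 : ∀ {G H} → type G ≡ 𝒫 → H ≺ G → type H ≡ 𝒪
𝒫⇒option-𝒪 h (option i) = classify≡𝒫 _ _ h i

⊕-options : ∀ n (f : Fin n → Game) m (g : Fin m → Game) → Fin (n +ℕ m) → Game
⊕-options n f m g k = [ (λ i → f i ⊕ mk m g) , (λ j → mk n f ⊕ g j) ] (splitAt n k)

⊕-options-↑ˡ : ∀ n f m g (i : Fin n) → ⊕-options n f m g (i ↑ˡ m) ≡ f i ⊕ mk m g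
⊕-options-↑ˡ n f m g i rewrite splitAt-↑ˡ n i m = refl

⊕-options-↑ʳ : ∀ n f m g (j : Fin m) → ⊕-options n f m g (n ↑ʳ j) ≡ mk n f ⊕ g j
⊕-options-↑ʳ n f m g j rewrite splitAt-↑ʳ n m j = refl

⊕-≺ˡ : ∀ {X X′} Y → X′ ≺ X → X′ ⊕ Y ≺ X ⊕ Y
⊕-≺ˡ (mk m g) (option {n} {f} i) =
  subst (_≺ mk n f ⊕ mk m g) (⊕-options-↑ˡ n f m g i) (option (i ↑ˡ m))

⊕-≺ʳ : ∀ X {Y Y′} → Y′ ≺ Y → X ⊕ Y′ ≺ X ⊕ Y
⊕-≺ʳ (mk n f) (option {m} {g} j) =
  subst (_≺ mk n f ⊕ mk m g) (⊕-options-↑ʳ n f m g j) (option (n ↑ʳ j))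

data ⊕-Option (X Y : Game) : Game → Set where
  left  : ∀ X′ → X′ ≺ X → ⊕-Option X Y (X′ ⊕ Y)
  right : ∀ Y′ → Y′ ≺ Y → ⊕-Option X Y (X ⊕ Y′)

⊕-option : ∀ X Y {Z} → Z ≺ X ⊕ Y → ⊕-Option X Y Z
⊕-option (mk n f) (mk m g) (option k) with splitAt n k
... | inj₁ i = left (f i) (option i)
... | inj₂ j = right (g j) (option j)

-- Matching the option witnesses against `option _` exposes X′ (resp. Y′) as an
-- immediate subterm of X (resp. Y), so the recursion is structural in (X, Y).
mutual
  𝒪⊕𝒫≢𝒩 : ∀ X Y → type X ≡ 𝒪 → type Y ≡ 𝒫 → type (X ⊕ Y) ≢ 𝒩
  𝒪⊕𝒫≢𝒩 X Y x𝒪 y𝒫 s𝒩 with 𝒩⇒∃𝒫-option (X ⊕ Y) s𝒩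
  ... | _ , Z≺ , z𝒫 with ⊕-option X Y Z≺
  ... | left  X′ X′≺X@(option _) = 𝒩⊕𝒫≢𝒫 X′ Y (𝒪⇒option-𝒩 x𝒪 X′≺X) y𝒫 z𝒫
  ... | right Y′ Y′≺Y@(option _) = 𝒪⊕𝒪≢𝒫 X Y′ x𝒪 (𝒫⇒option-𝒪 y𝒫 Y′≺Y) z𝒫

  𝒫⊕𝒪≢𝒩 : ∀ X Y → type X ≡ 𝒫 → type Y ≡ 𝒪 → type (X ⊕ Y) ≢ 𝒩
  𝒫⊕𝒪≢𝒩 X Y x𝒫 y𝒪 s𝒩 with 𝒩⇒∃𝒫-option (X ⊕ Y) s𝒩
  ... | _ , Z≺ , z𝒫 with ⊕-option X Y Z≺
  ... | left  X′ X′≺X@(option _) = 𝒪⊕𝒪≢𝒫 X′ Y (𝒫⇒option-𝒪 x𝒫 X′≺X) y𝒪 z𝒫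
  ... | right Y′ Y′≺Y@(option _) = 𝒫⊕𝒩≢𝒫 X Y′ x𝒫 (𝒪⇒option-𝒩 y𝒪 Y′≺Y) z𝒫

  𝒩⊕𝒫≢𝒫 : ∀ X Y → type X ≡ 𝒩 → type Y ≡ 𝒫 → type (X ⊕ Y) ≢ 𝒫
  𝒩⊕𝒫≢𝒫 X Y x𝒩 y𝒫 s𝒫 with 𝒩⇒∃𝒫-option X x𝒩
  ... | X′ , X′≺X@(option _) , x′𝒫 = 𝒫⊕𝒫≢𝒪 X′ Y x′𝒫 y𝒫 (𝒫⇒option-𝒪 s𝒫 (⊕-≺ˡ Y X′≺X))

  𝒫⊕𝒩≢𝒫 : ∀ X Y → type X ≡ 𝒫 → type Y ≡ 𝒩 → type (X ⊕ Y) ≢ 𝒫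
  𝒫⊕𝒩≢𝒫 X Y x𝒫 y𝒩 s𝒫 with 𝒩⇒∃𝒫-option Y y𝒩
  ... | Y′ , Y′≺Y@(option _) , y′𝒫 = 𝒫⊕𝒫≢𝒪 X Y′ x𝒫 y′𝒫 (𝒫⇒option-𝒪 s𝒫 (⊕-≺ʳ X Y′≺Y))

  𝒪⊕𝒪≢𝒫 : ∀ X Y → type X ≡ 𝒪 → type Y ≡ 𝒪 → type (X ⊕ Y) ≢ 𝒫
  𝒪⊕𝒪≢𝒫 X Y x𝒪 y𝒪 s𝒫 with 𝒪⇒∃𝒩-option Y y𝒪
  ... | Y′ , Y′≺Y@(option _) , y′𝒩 = 𝒪⊕𝒩≢𝒪 X Y′ x𝒪 y′𝒩 (𝒫⇒option-𝒪 s𝒫 (⊕-≺ʳ X Y′≺Y))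

  𝒫⊕𝒫≢𝒪 : ∀ X Y → type X ≡ 𝒫 → type Y ≡ 𝒫 → type (X ⊕ Y) ≢ 𝒪
  𝒫⊕𝒫≢𝒪 X Y x𝒫 y𝒫 s𝒪 with 𝒪⇒∃𝒩-option (X ⊕ Y) s𝒪
  ... | _ , Z≺ , z𝒩 with ⊕-option X Y Z≺
  ... | left  X′ X′≺X@(option _) = 𝒪⊕𝒫≢𝒩 X′ Y (𝒫⇒option-𝒪 x𝒫 X′≺X) y𝒫 z𝒩
  ... | right Y′ Y′≺Y@(option _) = 𝒫⊕𝒪≢𝒩 X Y′ x𝒫 (𝒫⇒option-𝒪 y𝒫 Y′≺Y) z𝒩

  𝒪⊕𝒩≢𝒪 : ∀ X Y → type X ≡ 𝒪 → type Y ≡ 𝒩 → type (X ⊕ Y) ≢ 𝒪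
  𝒪⊕𝒩≢𝒪 X Y x𝒪 y𝒩 s𝒪 with 𝒩⇒∃𝒫-option Y y𝒩
  ... | Y′ , Y′≺Y@(option _) , y′𝒫 = 𝒪⊕𝒫≢𝒩 X Y′ x𝒪 y′𝒫 (𝒪⇒option-𝒩 s𝒪 (⊕-≺ʳ X Y′≺Y))

claim1 : (X Y : Game) →
    ¬ (type X ≡ 𝒪 × type Y ≡ 𝒫 × type (X ⊕ Y) ≡ 𝒩) ×
    ¬ (type X ≡ 𝒩 × type Y ≡ 𝒫 × type (X ⊕ Y) ≡ 𝒫) ×
    ¬ (type X ≡ 𝒪 × type Y ≡ 𝒪 × type (X ⊕ Y) ≡ 𝒫) ×
    ¬ (type X ≡ 𝒫 × type Y ≡ 𝒫 × type (X ⊕ Y) ≡ 𝒪) ×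
    ¬ (type X ≡ 𝒪 × type Y ≡ 𝒩 × type (X ⊕ Y) ≡ 𝒪)
claim1 X Y =
  (λ (x , y , s) → 𝒪⊕𝒫≢𝒩 X Y x y s) ,
  (λ (x , y , s) → 𝒩⊕𝒫≢𝒫 X Y x y s) ,
  (λ (x , y , s) → 𝒪⊕𝒪≢𝒫 X Y x y s) ,
  (λ (x , y , s) → 𝒫⊕𝒫≢𝒪 X Y x y s) ,
  (λ (x , y , s) → 𝒪⊕𝒩≢𝒪 X Y x y s)
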